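{- Let $G=(V,E)$ be a simple, finite, connected graph and let $K>0$ be such that $\kappa(x,y)\geq K$ for all adjacent vertices $x\sim y$. Then \[ \operatorname{diam}_{\mathrm{eff}}(G)\leq \frac{\max_{x\in V}\operatorname{Deg}(x)}{K}. \]
   Context: $d$ denotes the combinatorial graph distance, $\operatorname{Deg}(x)=|\{y\in V: y\sim x\}|$, and the effective diameter is $\operatorname{diam}_{\mathrm{eff}}(G)=\frac{1}{|V|^2}\sum_{x,y\in V}d(x,y)$. The (non-normalized) Laplacian is $\Delta f(x)=\sum_{y\sim x}(f(y)-f(x))$ for $f\in\mathbb{R}^V$. For $f\in\mathbb{R}^V$ let $\|\nabla f\|_\infty=\max_{x\sim y}|f(y)-f(x)|$. The Ollivier curvature of an edge $x\sim y$ is $\kappa(x,y)=\inf\{\Delta f(x)-\Delta f(y): f\in\mathbb{R}^V,\ f(y)-f(x)=1,\ \|\nabla f\|_\infty=1\}$.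
   Formalization: The curvature bound K is a positive rational, and the test functions f in the definition of κ(x,y) take values in ℚ rather than in ℝ. -}

module Defs where

open import Data.Nat as ℕ using (ℕ; zero; suc; _⊔_)
open import Data.Nat.Properties using (m*n≢0)
open import Data.Fin using (Fin)
open import Data.List using (List; map; foldr)
open import Data.Bool using (Bool; true; false; if_then_else_)
open import Data.Product using (Σ; _×_; ∃)
open import Data.Integer using (+_)
open import Data.Rational using (ℚ; 0ℚ; 1ℚ; _+_; _-_; _≤_; ∣_∣; _/_)
open import Relation.Binary.PropositionalEquality using (_≡_; _≢_)
import Data.List as L

verts : (n : ℕ) → List (Fin n)
verts n = L.allFin n

Σℕ : (n : ℕ) → (Fin n → ℕ) → ℕ
Σℕ n g = foldr ℕ._+_ 0 (map g (verts n))

Σℚ : (n : ℕ) → (Fin n → ℚ) → ℚ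
Σℚ n g = foldr _+_ 0ℚ (map g (verts n))

record SimpleGraph (n : ℕ) : Set where
  field
    adj       : Fin n → Fin n → Bool
    adj-sym   : ∀ x y → adj x y ≡ adj y x
    adj-irrefl : ∀ x → adj x x ≡ false
open SimpleGraph public

module _ {n : ℕ} (G : SimpleGraph n) where

  _∼_ : Fin n → Fin n → Set
  x ∼ y = adj G x y ≡ true

  data Walk : Fin n → Fin n → ℕ → Set where
    [] : ∀ {x} → Walk x x 0
    _∷_ : ∀ {x y z k} → x ∼ y → Walk y z k → Walk x z (suc k)

  Connected : Set
  Connected = ∀ x y → ∃ λ k → Walk x y k

  IsDist : Fin n → Fin n → ℕ → Set
  IsDist x y k = Walk x y k × (∀ m → Walk x y m → k ℕ.≤ m)

  Deg : Fin n → ℕ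
  Deg x = Σℕ n (λ y → if adj G x y then 1 else 0)

  maxDeg : ℕ
  maxDeg = foldr _⊔_ 0 (map Deg (verts n))

  Δ : (Fin n → ℚ) → Fin n → ℚ
  Δ f x = Σℚ n (λ y → if adj G x y then f y - f x else 0ℚ)

  GradNormOne : (Fin n → ℚ) → Set
  GradNormOne f = (∀ x y → x ∼ y → ∣ f y - f x ∣ ≤ 1ℚ)
                × (∃ λ x → ∃ λ y → x ∼ y × ∣ f y - f x ∣ ≡ 1ℚ)

  -- κ(x,y) ≥ K, i.e. K is a lower bound of
  -- {Δf(x) - Δf(y) : f(y) - f(x) = 1, ‖∇f‖∞ = 1}
  CurvLowerBound : Fin n → Fin n → ℚ → Set
  CurvLowerBound x y K = ∀ (f : Fin n → ℚ) → f y - f x ≡ 1ℚ → GradNormOne f →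
                         K ≤ Δ f x - Δ f y

  diamEff : .{{_ : ℕ.NonZero n}} → (Fin n → Fin n → ℕ) → ℚ
  diamEff D = (+ Σℕ n (λ x → Σℕ n (λ y → D x y))) / (n ℕ.* n)
    where instance _ = m*n≢0 n n

-- Fix x and let f = d(x, ·). Along a geodesic from x to y the function f rises by exactly
-- one at each step, so summing the curvature bound over its edges and telescoping gives
-- K d(x,y) ≤ Δf(x) − Δf(y). Summing over y, the Laplacian has total mass zero, hence
-- K Σ_y d(x,y) ≤ n Δf(x) ≤ n Deg(x), the last step because f is 1-Lipschitz.
-- Summing over x and dividing by K n² gives the bound.
module Submission where

open import Defs
open import Data.Nat using (ℕ; NonZero)
open import Data.Fin using (Fin)
open import Data.Integer using (+_)
open import Data.Rational using (ℚ; 0ℚ; _<_; _≤_; _÷_; _/_; >-nonZero)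

open import Algebra.Bundles using (CommutativeRing)
open import Data.Bool using (true; false; if_then_else_)
open import Data.Fin using (zero; suc)
import Data.Integer as ℤ
import Data.Integer.Properties as ℤ
import Data.Integer.Tactic.RingSolver as ℤ-Solver
open import Data.List using (List; _∷_; map; foldr; allFin; tabulate)
open import Data.List.Membership.Propositional using (_∈_)
open import Data.List.Membership.Propositional.Properties using (∈-allFin; ∈-map⁺)
open import Data.List.Properties using (map-tabulate)
open import Data.List.Relation.Unary.Any using (here; there)
open import Data.Maybe using (Maybe; just; nothing)
open import Data.Nat as ℕ using (suc; _⊔_)
import Data.Nat.Properties as ℕ
open import Data.Product using (_×_; _,_; proj₁; proj₂)
open import Data.Sum using (inj₁; inj₂)
open import Data.Rational using (1ℚ; ½; _+_; _*_; -_; _-_; ∣_∣; 1/_; toℚᵘ; Positive; positive)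
open import Data.Rational.Properties
  using ( _≟_; +-*-commutativeRing; +-inverseʳ; +-identityʳ; *-assoc; *-identityʳ; *-inverseʳ
        ; *-zeroˡ; *-zeroʳ; ≤-refl; ≤-reflexive; ≤-trans; ≤-total; +-mono-≤; *-monoˡ-≤-nonNeg
        ; *-cancelˡ-≤-pos; nonNegative⁻¹; 0≤∣p∣; 0≤p⇒∣p∣≡p; pos*pos⇒pos; pos⇒nonZero
        ; normalize-nonNeg; normalize-pos; toℚᵘ-injective; toℚᵘ-fromℚᵘ; toℚᵘ-homo-+
        ; toℚᵘ-homo-*; toℚᵘ-cancel-≤; module ≤-Reasoning)
import Data.Rational.Unnormalised as ℚᵘ
import Data.Rational.Unnormalised.Properties as ℚᵘ
open import Data.Unit using (⊤; tt)
import Data.Vec.Functional as Vector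
open import Function using (_∘_)
open import Relation.Binary using (tri<; tri≈; tri>)
open import Relation.Binary.PropositionalEquality
open import Relation.Nullary using (yes; no)
open import Tactic.RingSolver using (solve-∀)
open import Tactic.RingSolver.Core.AlmostCommutativeRing using (AlmostCommutativeRing; fromCommutativeRing)

open import Algebra.Properties.Semiring.Sum (CommutativeRing.semiring +-*-commutativeRing)
  using (sum; sum-syntax; sum-cong-≗; ∑-comm; ∑-distrib-+; sum-replicate-zero; *-distribˡ-sum)

ℚ-ring : AlmostCommutativeRing _ _
ℚ-ring = fromCommutativeRing +-*-commutativeRing 0≟_
  where
  0≟_ : (p : ℚ) → Maybe (0ℚ ≡ p)
  0≟ p with 0ℚ ≟ p
  ... | yes 0≡p = just 0≡p
  ... | no _    = nothing

p≤∣p∣ : ∀ p → p ≤ ∣ p ∣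
p≤∣p∣ p with ≤-total 0ℚ p
... | inj₁ 0≤p = ≤-reflexive (sym (0≤p⇒∣p∣≡p 0≤p))
... | inj₂ p≤0 = ≤-trans p≤0 (0≤∣p∣ p)

p+p≡0⇒p≡0 : ∀ {p} → p + p ≡ 0ℚ → p ≡ 0ℚ
p+p≡0⇒p≡0 {p} p+p≡0 = begin
  p               ≡⟨ *-identityʳ p ⟨
  p * (½ + ½)     ≡⟨ identity p ½ ⟩
  (p + p) * ½     ≡⟨ cong (_* ½) p+p≡0 ⟩
  0ℚ * ½          ≡⟨ *-zeroˡ ½ ⟩
  0ℚ              ∎
  where
  open ≡-Reasoning
  identity : ∀ (q r : ℚ) → q * (r + r) ≡ (q + q) * r
  identity = solve-∀ ℚ-ring

fromℕ : ℕ → ℚ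
fromℕ k = + k / 1

toℚᵘ-fromℕ : ∀ k → toℚᵘ (fromℕ k) ℚᵘ.≃ ℚᵘ.mkℚᵘ (+ k) 0
toℚᵘ-fromℕ k = toℚᵘ-fromℚᵘ (ℚᵘ.mkℚᵘ (+ k) 0)

fromℕ-+ : ∀ m n → fromℕ (m ℕ.+ n) ≡ fromℕ m + fromℕ n
fromℕ-+ m n = toℚᵘ-injective (begin
  toℚᵘ (fromℕ (m ℕ.+ n))                         ≈⟨ toℚᵘ-fromℕ (m ℕ.+ n) ⟩
  ℚᵘ.mkℚᵘ (+ (m ℕ.+ n)) 0                        ≈⟨ ℚᵘ.*≡* (trans (cong (ℤ._* (+ 1 ℤ.* + 1)) (ℤ.pos-+ m n))
                                                                  (ℤ-identity (+ m) (+ n))) ⟩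
  ℚᵘ.mkℚᵘ (+ m) 0 ℚᵘ.+ ℚᵘ.mkℚᵘ (+ n) 0           ≈⟨ ℚᵘ.+-cong (toℚᵘ-fromℕ m) (toℚᵘ-fromℕ n) ⟨
  toℚᵘ (fromℕ m) ℚᵘ.+ toℚᵘ (fromℕ n)             ≈⟨ toℚᵘ-homo-+ (fromℕ m) (fromℕ n) ⟨
  toℚᵘ (fromℕ m + fromℕ n)                       ∎)
  where
  open ℚᵘ.≃-Reasoning
  ℤ-identity : ∀ (i j : ℤ.ℤ) → (i ℤ.+ j) ℤ.* (+ 1 ℤ.* + 1) ≡ (i ℤ.* + 1 ℤ.+ j ℤ.* + 1) ℤ.* + 1
  ℤ-identity = ℤ-Solver.solve-∀

fromℕ-* : ∀ m n → fromℕ (m ℕ.* n) ≡ fromℕ m * fromℕ n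
fromℕ-* m n = toℚᵘ-injective (begin
  toℚᵘ (fromℕ (m ℕ.* n))                         ≈⟨ toℚᵘ-fromℕ (m ℕ.* n) ⟩
  ℚᵘ.mkℚᵘ (+ (m ℕ.* n)) 0                        ≈⟨ ℚᵘ.*≡* (trans (cong (ℤ._* (+ 1 ℤ.* + 1)) (ℤ.pos-* m n))
                                                                  (ℤ-identity (+ m) (+ n))) ⟩
  ℚᵘ.mkℚᵘ (+ m) 0 ℚᵘ.* ℚᵘ.mkℚᵘ (+ n) 0           ≈⟨ ℚᵘ.*-cong (toℚᵘ-fromℕ m) (toℚᵘ-fromℕ n) ⟨
  toℚᵘ (fromℕ m) ℚᵘ.* toℚᵘ (fromℕ n)             ≈⟨ toℚᵘ-homo-* (fromℕ m) (fromℕ n) ⟨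
  toℚᵘ (fromℕ m * fromℕ n)                       ∎)
  where
  open ℚᵘ.≃-Reasoning
  ℤ-identity : ∀ (i j : ℤ.ℤ) → (i ℤ.* j) ℤ.* (+ 1 ℤ.* + 1) ≡ (i ℤ.* j) ℤ.* + 1
  ℤ-identity = ℤ-Solver.solve-∀

fromℕ-*-/ : ∀ m d .{{_ : NonZero d}} → fromℕ d * (+ m / d) ≡ fromℕ m
fromℕ-*-/ m (suc d) = toℚᵘ-injective (begin
  toℚᵘ (fromℕ (suc d) * (+ m / suc d))           ≈⟨ toℚᵘ-homo-* (fromℕ (suc d)) (+ m / suc d) ⟩
  toℚᵘ (fromℕ (suc d)) ℚᵘ.* toℚᵘ (+ m / suc d)   ≈⟨ ℚᵘ.*-cong (toℚᵘ-fromℕ (suc d)) (toℚᵘ-fromℚᵘ (ℚᵘ.mkℚᵘ (+ m) d)) ⟩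
  ℚᵘ.mkℚᵘ (+ suc d) 0 ℚᵘ.* ℚᵘ.mkℚᵘ (+ m) d       ≈⟨ ℚᵘ.*≡* (ℤ-identity (+ m) (+ suc d)) ⟩
  ℚᵘ.mkℚᵘ (+ m) 0                                ≈⟨ toℚᵘ-fromℕ m ⟨
  toℚᵘ (fromℕ m)                                 ∎)
  where
  open ℚᵘ.≃-Reasoning
  ℤ-identity : ∀ (i j : ℤ.ℤ) → (j ℤ.* i) ℤ.* + 1 ≡ i ℤ.* (+ 1 ℤ.* j)
  ℤ-identity = ℤ-Solver.solve-∀

fromℕ-mono-≤ : ∀ {m n} → m ℕ.≤ n → fromℕ m ≤ fromℕ n
fromℕ-mono-≤ {m} {n} m≤n = toℚᵘ-cancel-≤
  (ℚᵘ.≤-respʳ-≃ (ℚᵘ.≃-sym (toℚᵘ-fromℕ n)) (ℚᵘ.≤-respˡ-≃ (ℚᵘ.≃-sym (toℚᵘ-fromℕ m))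
    (ℚᵘ.*≤* (ℤ.*-monoʳ-≤-nonNeg (+ 1) (ℤ.+≤+ m≤n)))))

fromℕ[1+m]-fromℕ[m]≡1 : ∀ m → fromℕ (suc m) - fromℕ m ≡ 1ℚ
fromℕ[1+m]-fromℕ[m]≡1 m = trans (cong (_- fromℕ m) (fromℕ-+ 1 m)) (identity 1ℚ (fromℕ m))
  where
  identity : ∀ (p q : ℚ) → (p + q) - q ≡ p
  identity = solve-∀ ℚ-ring

∣fromℕ-fromℕ∣≤1 : ∀ {m n} → m ℕ.≤ suc n → n ℕ.≤ suc m → ∣ fromℕ m - fromℕ n ∣ ≤ 1ℚ
∣fromℕ-fromℕ∣≤1 {m} {n} m≤1+n n≤1+m with ℕ.<-cmp m n
... | tri< m<n _ _ = ≤-reflexive (begin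
  ∣ fromℕ m - fromℕ n ∣             ≡⟨ cong (λ k → ∣ fromℕ m - fromℕ k ∣) (ℕ.≤-antisym n≤1+m m<n) ⟩
  ∣ fromℕ m - fromℕ (suc m) ∣       ≡⟨ cong ∣_∣ (antisymmetric (fromℕ (suc m)) (fromℕ m)) ⟩
  ∣ - (fromℕ (suc m) - fromℕ m) ∣   ≡⟨ cong (∣_∣ ∘ -_) (fromℕ[1+m]-fromℕ[m]≡1 m) ⟩
  1ℚ                                ∎)
  where
  open ≡-Reasoning
  antisymmetric : ∀ (p q : ℚ) → q - p ≡ - (p - q)
  antisymmetric = solve-∀ ℚ-ring
... | tri≈ _ refl _ = ≤-trans (≤-reflexive (cong ∣_∣ (+-inverseʳ (fromℕ m)))) (nonNegative⁻¹ 1ℚ)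
... | tri> _ _ n<m = ≤-reflexive (begin
  ∣ fromℕ m - fromℕ n ∣             ≡⟨ cong (λ k → ∣ fromℕ k - fromℕ n ∣) (ℕ.≤-antisym m≤1+n n<m) ⟩
  ∣ fromℕ (suc n) - fromℕ n ∣       ≡⟨ cong ∣_∣ (fromℕ[1+m]-fromℕ[m]≡1 n) ⟩
  1ℚ                                ∎)
  where open ≡-Reasoning

foldr-allFin : ∀ {A : Set} (_∙_ : A → A → A) (ε : A) {n} (g : Fin n → A) →
               foldr _∙_ ε (map g (allFin n)) ≡ Vector.foldr _∙_ ε g
foldr-allFin _∙_ ε g = trans (cong (foldr _∙_ ε) (map-tabulate (λ i → i) g)) (foldr-tabulate g)
  where
  foldr-tabulate : ∀ {n} (g : Fin n → _) → foldr _∙_ ε (tabulate g) ≡ Vector.foldr _∙_ ε g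
  foldr-tabulate {ℕ.zero} g = refl
  foldr-tabulate {suc n}  g = cong (g zero ∙_) (foldr-tabulate (g ∘ suc))

Σℚ≡sum : ∀ {n} (g : Fin n → ℚ) → Σℚ n g ≡ sum g
Σℚ≡sum = foldr-allFin _+_ 0ℚ

fromℕ-Σℕ : ∀ {n} (g : Fin n → ℕ) → fromℕ (Σℕ n g) ≡ sum (fromℕ ∘ g)
fromℕ-Σℕ g = trans (cong fromℕ (foldr-allFin ℕ._+_ 0 g)) (fromℕ-foldr g)
  where
  fromℕ-foldr : ∀ {n} (g : Fin n → ℕ) → fromℕ (Vector.foldr ℕ._+_ 0 g) ≡ sum (fromℕ ∘ g)
  fromℕ-foldr {ℕ.zero} g = refl
  fromℕ-foldr {suc n}  g = trans (fromℕ-+ (g zero) _) (cong (_+_ (fromℕ (g zero))) (fromℕ-foldr (g ∘ suc)))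

sum-mono-≤ : ∀ {n} {f g : Fin n → ℚ} → (∀ i → f i ≤ g i) → sum f ≤ sum g
sum-mono-≤ {ℕ.zero} f≤g = ≤-refl
sum-mono-≤ {suc n}  f≤g = +-mono-≤ (f≤g zero) (sum-mono-≤ (f≤g ∘ suc))

sum-const : ∀ n (c : ℚ) → sum {n} (λ _ → c) ≡ fromℕ n * c
sum-const ℕ.zero c  = sym (*-zeroˡ c)
sum-const (suc n) c = begin
  c + sum {n} (λ _ → c)   ≡⟨ cong (_+_ c) (sum-const n c) ⟩
  c + fromℕ n * c         ≡⟨ identity c (fromℕ n) ⟩
  (1ℚ + fromℕ n) * c      ≡⟨ cong (_* c) (fromℕ-+ 1 n) ⟨
  fromℕ (suc n) * c       ∎
  where
  open ≡-Reasoning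
  identity : ∀ (p q : ℚ) → p + q * p ≡ (1ℚ + q) * p
  identity = solve-∀ ℚ-ring

sum-distrib-- : ∀ {n} (f g : Fin n → ℚ) → sum (λ i → f i - g i) ≡ sum f - sum g
sum-distrib-- {ℕ.zero} f g = refl
sum-distrib-- {suc n}  f g =
  trans (cong (_+_ (f zero - g zero)) (sum-distrib-- (f ∘ suc) (g ∘ suc)))
        (identity (f zero) (g zero) (sum (f ∘ suc)) (sum (g ∘ suc)))
  where
  identity : ∀ (p q r s : ℚ) → (p - q) + (r - s) ≡ (p + r) - (q + s)
  identity = solve-∀ ℚ-ring

*-Σℕ-≤-sum : ∀ {n} (K : ℚ) {g : Fin n → ℕ} {h : Fin n → ℚ} →
              (∀ i → K * fromℕ (g i) ≤ h i) → K * fromℕ (Σℕ n g) ≤ sum h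
*-Σℕ-≤-sum K {g} {h} K*g≤h = begin
  K * fromℕ (Σℕ _ g)           ≡⟨ cong (K *_) (fromℕ-Σℕ g) ⟩
  K * sum (fromℕ ∘ g)          ≡⟨ *-distribˡ-sum K (fromℕ ∘ g) ⟩
  sum (λ i → K * fromℕ (g i))  ≤⟨ sum-mono-≤ K*g≤h ⟩
  sum h                        ∎
  where open ≤-Reasoning

m∈xs⇒m≤foldr-⊔ : ∀ {m} {xs : List ℕ} → m ∈ xs → m ℕ.≤ foldr _⊔_ 0 xs
m∈xs⇒m≤foldr-⊔ {xs = x ∷ xs} (here refl) = ℕ.m≤m⊔n x _
m∈xs⇒m≤foldr-⊔ {xs = x ∷ xs} (there m∈xs) = ℕ.≤-trans (m∈xs⇒m≤foldr-⊔ m∈xs) (ℕ.m≤n⊔m x _)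

module _ {n : ℕ} (G : SimpleGraph n) where

  infixr 5 _++ʷ_
  _++ʷ_ : ∀ {x y z k m} → Walk G x y k → Walk G y z m → Walk G x z (k ℕ.+ m)
  []      ++ʷ w = w
  (e ∷ v) ++ʷ w = e ∷ (v ++ʷ w)

  ∼-sym : ∀ {x y} → _∼_ G x y → _∼_ G y x
  ∼-sym {x} {y} x∼y = trans (adj-sym G y x) x∼y

  OneLipschitz : (Fin n → ℚ) → Set
  OneLipschitz f = ∀ x y → _∼_ G x y → ∣ f y - f x ∣ ≤ 1ℚ

  Ascending : (Fin n → ℚ) → ∀ {x y k} → Walk G x y k → Set
  Ascending f []                 = ⊤
  Ascending f (_∷_ {x} {y} _ w) = f y - f x ≡ 1ℚ × Ascending f w

  Deg≤maxDeg : ∀ x → Deg G x ℕ.≤ maxDeg G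
  Deg≤maxDeg x = m∈xs⇒m≤foldr-⊔ (∈-map⁺ (Deg G) (∈-allFin x))

  Δ≤Deg : ∀ {f} → OneLipschitz f → ∀ x → Δ G f x ≤ fromℕ (Deg G x)
  Δ≤Deg {f} lip x = begin
    Δ G f x                                                  ≡⟨ Σℚ≡sum (λ y → if adj G x y then f y - f x else 0ℚ) ⟩
    ∑[ y < n ] (if adj G x y then f y - f x else 0ℚ)         ≤⟨ sum-mono-≤ edge≤indicator ⟩
    ∑[ y < n ] fromℕ (if adj G x y then 1 else 0)            ≡⟨ fromℕ-Σℕ (λ y → if adj G x y then 1 else 0) ⟨
    fromℕ (Deg G x)                                          ∎
    where
    open ≤-Reasoning
    edge≤indicator : ∀ y → (if adj G x y then f y - f x else 0ℚ) ≤ fromℕ (if adj G x y then 1 else 0)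
    edge≤indicator y with adj G x y in x∼y
    ... | true  = ≤-trans (p≤∣p∣ (f y - f x)) (lip x y x∼y)
    ... | false = ≤-refl

  -- Each edge is counted twice in the double sum, with opposite signs.
  sum-Δ≡0 : ∀ g → sum (Δ G g) ≡ 0ℚ
  sum-Δ≡0 g = trans (sum-cong-≗ (λ x → Σℚ≡sum (flow x))) (p+p≡0⇒p≡0 (begin
    S + S                                                    ≡⟨ cong (_+_ S) (∑-comm flow) ⟩
    S + ∑[ x < n ] ∑[ y < n ] flow y x                       ≡⟨ ∑-distrib-+ (λ x → sum (flow x)) (λ x → ∑[ y < n ] flow y x) ⟨
    ∑[ x < n ] (∑[ y < n ] flow x y + ∑[ y < n ] flow y x)   ≡⟨ sum-cong-≗ (λ x → ∑-distrib-+ (flow x) (λ y → flow y x)) ⟨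
    ∑[ x < n ] ∑[ y < n ] (flow x y + flow y x)              ≡⟨ sum-cong-≗ (λ x → sum-cong-≗ (flow-antisym x)) ⟩
    ∑[ x < n ] ∑[ y < n ] 0ℚ                                 ≡⟨ sum-cong-≗ {n} (λ _ → sum-replicate-zero n) ⟩
    ∑[ x < n ] 0ℚ                                            ≡⟨ sum-replicate-zero n ⟩
    0ℚ                                                       ∎))
    where
    open ≡-Reasoning
    flow : Fin n → Fin n → ℚ
    flow x y = if adj G x y then g y - g x else 0ℚ
    S : ℚ
    S = ∑[ x < n ] ∑[ y < n ] flow x y
    flow-antisym : ∀ x y → flow x y + flow y x ≡ 0ℚ
    flow-antisym x y rewrite adj-sym G x y with adj G y x
    ... | true  = identity (g x) (g y)
      where
      identity : ∀ (p q : ℚ) → (q - p) + (p - q) ≡ 0ℚ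
      identity = solve-∀ ℚ-ring
    ... | false = refl

  module _ (K : ℚ) (curv : ∀ x y → _∼_ G x y → CurvLowerBound G x y K) where

    curvature-telescope : ∀ {f} → OneLipschitz f → ∀ {x y k} (w : Walk G x y k) → Ascending f w →
                          K * fromℕ k ≤ Δ G f x - Δ G f y
    curvature-telescope {f} lip {x} [] _ = ≤-reflexive (trans (*-zeroʳ K) (sym (+-inverseʳ (Δ G f x))))
    curvature-telescope {f} lip {x} {z} (_∷_ {y = y} {k = k} x∼y w) (up , ups) = begin
      K * fromℕ (suc k)                          ≡⟨ cong (K *_) (fromℕ-+ 1 k) ⟩
      K * (1ℚ + fromℕ k)                         ≡⟨ distrib K (fromℕ k) ⟩
      K + K * fromℕ k                            ≤⟨ +-mono-≤ edge (curvature-telescope lip w ups) ⟩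
      (Δ G f x - Δ G f y) + (Δ G f y - Δ G f z)  ≡⟨ telescope (Δ G f x) (Δ G f y) (Δ G f z) ⟩
      Δ G f x - Δ G f z                          ∎
      where
      open ≤-Reasoning
      edge : K ≤ Δ G f x - Δ G f y
      edge = curv x y x∼y f up (lip , x , y , x∼y , cong ∣_∣ up)
      distrib : ∀ (p q : ℚ) → p * (1ℚ + q) ≡ p + p * q
      distrib = solve-∀ ℚ-ring
      telescope : ∀ (p q r : ℚ) → (p - q) + (q - r) ≡ p - r
      telescope = solve-∀ ℚ-ring

  module _ (D : Fin n → Fin n → ℕ) (dist : ∀ x y → IsDist G x y (D x y)) where

    D-refl : ∀ x → D x x ≡ 0
    D-refl x = ℕ.n≤0⇒n≡0 (proj₂ (dist x x) 0 [])

    D-edge : ∀ x {y z} → _∼_ G y z → D x z ℕ.≤ suc (D x y)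
    D-edge x {y} {z} y∼z = subst (D x z ℕ.≤_) (ℕ.+-comm (D x y) 1)
      (proj₂ (dist x z) _ (proj₁ (dist x y) ++ʷ (y∼z ∷ [])))

    D-oneLipschitz : ∀ x → OneLipschitz (fromℕ ∘ D x)
    D-oneLipschitz x y z y∼z = ∣fromℕ-fromℕ∣≤1 (D-edge x y∼z) (D-edge x (∼-sym y∼z))

    -- The hypothesis says that a geodesic from x to y followed by w is a geodesic from x to z.
    geodesic-ascending : ∀ x {y z k} (w : Walk G y z k) → D x y ℕ.+ k ℕ.≤ D x z → Ascending (fromℕ ∘ D x) w
    geodesic-ascending x [] _ = tt
    geodesic-ascending x {y} {z} (_∷_ {y = y′} {k = k} y∼y′ w) Dxy+1+k≤Dxz =
      trans (cong (λ m → fromℕ m - fromℕ (D x y)) Dxy′≡1+Dxy) (fromℕ[1+m]-fromℕ[m]≡1 (D x y)) ,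
      geodesic-ascending x w (subst (λ m → m ℕ.+ k ℕ.≤ D x z) (sym Dxy′≡1+Dxy) 1+Dxy+k≤Dxz)
      where
      1+Dxy+k≤Dxz : suc (D x y) ℕ.+ k ℕ.≤ D x z
      1+Dxy+k≤Dxz = subst (ℕ._≤ D x z) (ℕ.+-suc (D x y) k) Dxy+1+k≤Dxz
      Dxz≤Dxy′+k : D x z ℕ.≤ D x y′ ℕ.+ k
      Dxz≤Dxy′+k = proj₂ (dist x z) _ (proj₁ (dist x y′) ++ʷ w)
      Dxy′≡1+Dxy : D x y′ ≡ suc (D x y)
      Dxy′≡1+Dxy = ℕ.≤-antisym (D-edge x y∼y′)
                     (ℕ.+-cancelʳ-≤ k _ _ (ℕ.≤-trans 1+Dxy+k≤Dxz Dxz≤Dxy′+k))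

    module _ (K : ℚ) (curv : ∀ x y → _∼_ G x y → CurvLowerBound G x y K) where

      K*D≤ΔD : ∀ x y → K * fromℕ (D x y) ≤ Δ G (fromℕ ∘ D x) x - Δ G (fromℕ ∘ D x) y
      K*D≤ΔD x y = curvature-telescope K curv (D-oneLipschitz x) geodesic
                     (geodesic-ascending x geodesic (ℕ.≤-reflexive (cong (ℕ._+ D x y) (D-refl x))))
        where
        geodesic : Walk G x y (D x y)
        geodesic = proj₁ (dist x y)

      K*ΣD≤n*maxDeg : ∀ x → K * fromℕ (Σℕ n (D x)) ≤ fromℕ n * fromℕ (maxDeg G)
      K*ΣD≤n*maxDeg x = begin
        K * fromℕ (Σℕ n (D x))                 ≤⟨ *-Σℕ-≤-sum K (K*D≤ΔD x) ⟩
        ∑[ y < n ] (Δ G f x - Δ G f y)         ≡⟨ sum-distrib-- (λ _ → Δ G f x) (Δ G f) ⟩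
        ∑[ y < n ] Δ G f x - sum (Δ G f)       ≡⟨ cong₂ _-_ (sum-const n (Δ G f x)) (sum-Δ≡0 f) ⟩
        fromℕ n * Δ G f x - 0ℚ                 ≡⟨ +-identityʳ (fromℕ n * Δ G f x) ⟩
        fromℕ n * Δ G f x                      ≤⟨ *-monoˡ-≤-nonNeg (fromℕ n) {{normalize-nonNeg n 1}}
                                                    (≤-trans (Δ≤Deg {f} (D-oneLipschitz x) x) (fromℕ-mono-≤ (Deg≤maxDeg x))) ⟩
        fromℕ n * fromℕ (maxDeg G)             ∎
        where
        open ≤-Reasoning
        f : Fin n → ℚ
        f = fromℕ ∘ D x

      K*ΣΣD≤n²*maxDeg : K * fromℕ (Σℕ n (λ x → Σℕ n (D x))) ≤ fromℕ (n ℕ.* n) * fromℕ (maxDeg G)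
      K*ΣΣD≤n²*maxDeg = begin
        K * fromℕ (Σℕ n (λ x → Σℕ n (D x)))      ≤⟨ *-Σℕ-≤-sum K K*ΣD≤n*maxDeg ⟩
        ∑[ x < n ] (fromℕ n * fromℕ (maxDeg G))  ≡⟨ sum-const n (fromℕ n * fromℕ (maxDeg G)) ⟩
        fromℕ n * (fromℕ n * fromℕ (maxDeg G))   ≡⟨ *-assoc (fromℕ n) (fromℕ n) (fromℕ (maxDeg G)) ⟨
        fromℕ n * fromℕ n * fromℕ (maxDeg G)     ≡⟨ cong (_* fromℕ (maxDeg G)) (fromℕ-* n n) ⟨
        fromℕ (n ℕ.* n) * fromℕ (maxDeg G)       ∎
        where open ≤-Reasoning

*≤*⇒/≤÷ : ∀ s d .{{_ : NonZero d}} (M K : ℚ) .{{_ : Positive K}} →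
        K * fromℕ s ≤ fromℕ d * M → + s / d ≤ (M ÷ K) {{pos⇒nonZero K}}
*≤*⇒/≤÷ s d M K K*s≤d*M = *-cancelˡ-≤-pos (fromℕ d * K) {{pos*pos⇒pos (fromℕ d) {{normalize-pos d 1}} K}} (begin
  fromℕ d * K * (+ s / d)         ≡⟨ swap (fromℕ d) K (+ s / d) ⟩
  K * (fromℕ d * (+ s / d))       ≡⟨ cong (K *_) (fromℕ-*-/ s d) ⟩
  K * fromℕ s                     ≤⟨ K*s≤d*M ⟩
  fromℕ d * M                     ≡⟨ *-identityʳ (fromℕ d * M) ⟨
  fromℕ d * M * 1ℚ                ≡⟨ cong (fromℕ d * M *_) (*-inverseʳ K {{pos⇒nonZero K}}) ⟨
  fromℕ d * M * (K * 1/K)         ≡⟨ interchange (fromℕ d) M K 1/K ⟩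
  fromℕ d * K * (M * 1/K)         ∎)
  where
  open ≤-Reasoning
  1/K : ℚ
  1/K = (1/ K) {{pos⇒nonZero K}}
  swap : ∀ (p q r : ℚ) → p * q * r ≡ q * (p * r)
  swap = solve-∀ ℚ-ring
  interchange : ∀ (p q r t : ℚ) → p * q * (r * t) ≡ p * r * (q * t)
  interchange = solve-∀ ℚ-ring

theorem3p1 : (n : ℕ) → .{{_ : NonZero n}} → (G : SimpleGraph n) → Connected G →
    (K : ℚ) → (Kpos : 0ℚ < K) →
    (∀ x y → _∼_ G x y → CurvLowerBound G x y K) →
    (D : Fin n → Fin n → ℕ) → (∀ x y → IsDist G x y (D x y)) →
    diamEff G D ≤ _÷_ ((+ maxDeg G) / 1) K {{>-nonZero Kpos}}
theorem3p1 n G _ K Kpos curv D dist =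
  *≤*⇒/≤÷ (Σℕ n (λ x → Σℕ n (D x))) (n ℕ.* n) {{ℕ.m*n≢0 n n}} (fromℕ (maxDeg G)) K {{positive Kpos}}
    (K*ΣΣD≤n²*maxDeg G D dist K curv)
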